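{- For positive integers $n,p$, let $\mathcal{S}^p_n=\{S\subset\{1,\ldots,n\}: \min S>|S|^p \text{ and } n\in S\}$ and $\mathcal{A}^p_n=\{S\subset\{1,\ldots,n\}: \min S\geqslant |S|^p \text{ and } n\in S\}$. Then for all $n,p\in\mathbb{N}$, $|\mathcal{S}^p_n| = K_{n,p-1}$. Furthermore, $|\mathcal{S}^p_1|=0$ and $|\mathcal{S}^p_{n+1}|=|\mathcal{A}^p_n|$; hence $|\mathcal{A}^p_n|=|\mathcal{S}^p_{n+1}|=K_{n+1,p-1}$.
   Context: For $n\in\mathbb{N}$ and integer $q\geqslant 0$, $K_{n,q}$ denotes the number of ordered tuples $(x_1,\ldots,x_k)$ of positive integers (with any $k\geqslant 1$) such that $\sum_{i=1}^k x_i=n$ and $\min_i x_i>k^q$, i.e. the number of compositions of $n$ whose smallest part is strictly greater than the number of parts raised to the power $q$. Here $\mathbb{N}=\{1,2,\ldots\}$. -}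

module Defs where

open import Data.Bool using (Bool; T)
open import Data.Nat using (ℕ; zero; suc; _+_; _^_; _≤_; _<_; _≤?_; _<?_; _≟_)
open import Data.Fin using (Fin; toℕ)
open import Data.Fin.Subset using (Subset; _∈_; ∣_∣)
open import Data.Fin.Subset.Properties using (_∈?_)
import Data.Fin.Properties as FinP
open import Data.Vec using (Vec; sum)
open import Data.Vec.Relation.Unary.All as VAll using (All)
open import Data.Product using (Σ; ∃; _×_; _,_)
open import Relation.Nullary using (Dec; ¬_)
open import Relation.Nullary.Decidable using (⌊_⌋; _×-dec_; _→-dec_)
open import Relation.Binary.PropositionalEquality using (_≡_)

-- Convention: S : Subset n represents a subset of {1,…,n};
-- index i : Fin n stands for the integer toℕ i + 1.

ContainsTop : {n : ℕ} → Subset n → Set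
ContainsTop {n} S = ∃ λ (i : Fin n) → (suc (toℕ i) ≡ n) × (i ∈ S)

containsTop? : {n : ℕ} (S : Subset n) → Dec (ContainsTop S)
containsTop? {n} S = FinP.any? (λ i → (suc (toℕ i) ≟ n) ×-dec (i ∈? S))

MinGt : {n : ℕ} → ℕ → Subset n → Set
MinGt {n} p S = (i : Fin n) → i ∈ S → ∣ S ∣ ^ p < suc (toℕ i)

minGt? : {n : ℕ} (p : ℕ) (S : Subset n) → Dec (MinGt p S)
minGt? p S = FinP.all? (λ i → (i ∈? S) →-dec (∣ S ∣ ^ p <? suc (toℕ _)))

MinGe : {n : ℕ} → ℕ → Subset n → Set
MinGe {n} p S = (i : Fin n) → i ∈ S → ∣ S ∣ ^ p ≤ suc (toℕ i)

minGe? : {n : ℕ} (p : ℕ) (S : Subset n) → Dec (MinGe p S)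
minGe? p S = FinP.all? (λ i → (i ∈? S) →-dec (∣ S ∣ ^ p ≤? suc (toℕ _)))

-- 𝒮^p_n as a type; the property is packaged as T ⌊ dec ⌋ so it is proof-irrelevant
-- and the type literally is the set of such subsets.
𝒮 : ℕ → ℕ → Set
𝒮 p n = Σ (Subset n) λ S → T ⌊ minGt? p S ×-dec containsTop? S ⌋

𝒜 : ℕ → ℕ → Set
𝒜 p n = Σ (Subset n) λ S → T ⌊ minGe? p S ×-dec containsTop? S ⌋

IsKComp : (n q k : ℕ) → Vec ℕ k → Set
IsKComp n q k x = (1 ≤ k) × (sum x ≡ n) × All (λ xi → 1 ≤ xi) x × All (λ xi → k ^ q < xi) x

isKComp? : (n q k : ℕ) (x : Vec ℕ k) → Dec (IsKComp n q k x)
isKComp? n q k x = (1 ≤? k) ×-dec (sum x ≟ n) ×-dec VAll.all? (1 ≤?_) x ×-dec VAll.all? (k ^ q <?_) x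

-- the set whose cardinality is K_{n,q}
KComp : ℕ → ℕ → Set
KComp n q = Σ ℕ λ k → Σ (Vec ℕ k) λ x → T ⌊ isKComp? n q k x ⌋

-- A set S ⊆ {1,…,n} is read as its indicator word of length n. If S ∈ 𝒮^p_n has k = |S|
-- elements, its word is k^p falses followed by a word r ending in true, with k trues and
-- length n − k^p. The gaps between consecutive trues of r form a composition of n − k^p
-- into k parts, and adding k^(p−1) to each part gives a composition of n into k parts that
-- all exceed k^(p−1); since k · k^(p−1) = k^p this is reversible. For 𝒮^p_{n+1} ≅ 𝒜^p_n,
-- the element 1 never lies in a set of 𝒮^p_{n+1} (because 1 ≤ |S|^p), so removing it and
-- shifting down turns "min S > |S|^p" into "min S ≥ |S|^p".
module Submission where

open import Defs
open import Data.Nat using (ℕ; suc; _∸_; _≤_)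
open import Data.Fin using (Fin)
open import Data.Product using (_×_)
open import Function.Bundles using (_↔_)

open import Data.Bool using (Bool; true; false; T)
open import Data.Bool.Properties using (T-irrelevant)
open import Data.Empty using (⊥-elim)
open import Data.Fin using (zero; suc; toℕ)
open import Data.Fin.Properties using (¬Fin0)
open import Data.Fin.Subset using (Subset; _∈_; ∣_∣)
open import Data.List using (List; []; _∷_; _++_; map; replicate; drop; length)
open import Data.List.Properties using (∷-injective; length-++; length-replicate; length-map; map-∘; map-cong; map-id; map-id-local)
open import Data.List.Relation.Unary.All using (All; []; _∷_)
import Data.List.Relation.Unary.All as All
open import Data.List.Relation.Unary.All.Properties using (map⁺)
open import Data.Nat using (zero; _+_; _*_; _^_; _<_; z≤n; s≤s)
open import Data.Nat.ListAction using (sum)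
open import Data.Nat.Properties
open import Algebra.Properties.CommutativeSemigroup +-commutativeSemigroup using (interchange)
open import Data.Product using (Σ; _,_; proj₁; proj₂)
open import Data.Vec using (Vec; toList; fromList; here; there)
import Data.Vec as Vec
open import Data.Vec.Properties using (length-toList; toList∘fromList)
open import Data.Vec.Relation.Unary.All.Properties using (toList⁺; fromList⁺)
open import Function.Bundles using (mk↔ₛ′)
open import Function.Properties.Inverse using (↔-trans; ↔-sym)
open import Function.Related.TypeIsomorphisms using (Σ-assoc)
open import Relation.Binary.PropositionalEquality
open import Relation.Nullary using (Dec; ¬_)
open import Relation.Nullary.Decidable using (_×-dec_; ⌊_⌋; toWitness; fromWitness)

record BijectionOn {X Y : Set} (P : X → Set) (Q : Y → Set) : Set where
  field
    to      : X → Y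
    from    : Y → X
    to-∈    : ∀ {x} → P x → Q (to x)
    from-∈  : ∀ {y} → Q y → P (from y)
    from∘to : ∀ {x} → P x → from (to x) ≡ x
    to∘from : ∀ {y} → Q y → to (from y) ≡ y

restrict : {X Y : Set} {P : X → Set} {Q : Y → Set}
           (P? : ∀ x → Dec (P x)) (Q? : ∀ y → Dec (Q y)) →
           BijectionOn P Q → Σ X (λ x → T ⌊ P? x ⌋) ↔ Σ Y (λ y → T ⌊ Q? y ⌋)
restrict P? Q? b = mk↔ₛ′
  (λ (x , t) → to x , fromWitness (to-∈ (toWitness t)))
  (λ (y , t) → from y , fromWitness (from-∈ (toWitness t)))
  (λ (y , t) → Σ-≡ Q? (to∘from (toWitness t)))
  (λ (x , t) → Σ-≡ P? (from∘to (toWitness t)))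
  where
  open BijectionOn b
  Σ-≡ : {Z : Set} {R : Z → Set} (R? : ∀ z → Dec (R z)) {z z′ : Z} → z ≡ z′ →
        {t : T ⌊ R? z ⌋} {t′ : T ⌊ R? z′ ⌋} → _≡_ {A = Σ Z (λ z → T ⌊ R? z ⌋)} (z , t) (z′ , t′)
  Σ-≡ R? refl = cong (_ ,_) (T-irrelevant _ _)

Σ-fromList∘toList : {A : Set} {k : ℕ} (x : Vec A k) →
                  _≡_ {A = Σ ℕ (Vec A)} (length (toList x) , fromList (toList x)) (k , x)
Σ-fromList∘toList Vec.[]      = refl
Σ-fromList∘toList (a Vec.∷ x) = cong (λ (m , y) → suc m , a Vec.∷ y) (Σ-fromList∘toList x)

sum-toList : {k : ℕ} (x : Vec ℕ k) → Vec.sum x ≡ sum (toList x)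
sum-toList Vec.[]      = refl
sum-toList (a Vec.∷ x) = cong (a +_) (sum-toList x)

drop-replicate-++ : {A : Set} (m : ℕ) (a : A) (xs : List A) → drop m (replicate m a ++ xs) ≡ xs
drop-replicate-++ zero    a xs = refl
drop-replicate-++ (suc m) a xs = drop-replicate-++ m a xs

replicate-++-∷ : {A : Set} (m : ℕ) (a : A) (xs : List A) →
                 replicate m a ++ a ∷ xs ≡ a ∷ replicate m a ++ xs
replicate-++-∷ zero    a xs = refl
replicate-++-∷ (suc m) a xs = cong (a ∷_) (replicate-++-∷ m a xs)

sum-map-+ : (c : ℕ) (xs : List ℕ) → sum (map (_+ c) xs) ≡ sum xs + length xs * c
sum-map-+ c []       = refl
sum-map-+ c (x ∷ xs) = trans (cong (x + c +_) (sum-map-+ c xs)) (interchange x c (sum xs) (length xs * c))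

map-∸-+ : (c : ℕ) (xs : List ℕ) → map (_∸ c) (map (_+ c) xs) ≡ xs
map-∸-+ c xs = trans (sym (map-∘ xs)) (trans (map-cong (λ x → m+n∸n≡m x c) xs) (map-id xs))

map-+-∸ : (c : ℕ) {xs : List ℕ} → All (c <_) xs → map (_+ c) (map (_∸ c) xs) ≡ xs
map-+-∸ c {xs} c<xs = trans (sym (map-∘ xs)) (map-id-local (All.map (λ c<x → m∸n+n≡m (<⇒≤ c<x)) c<xs))

data EndsInTrue : List Bool → Set where
  [true] : EndsInTrue (true ∷ [])
  _∷_    : ∀ b {bs} → EndsInTrue bs → EndsInTrue (b ∷ bs)

EndsInTrue-++ : ∀ as {bs} → EndsInTrue bs → EndsInTrue (as ++ bs)
EndsInTrue-++ []       e = e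
EndsInTrue-++ (a ∷ as) e = a ∷ EndsInTrue-++ as e

EndsInTrue-replicate⁻ : ∀ m {bs} → EndsInTrue (replicate m false ++ bs) → EndsInTrue bs
EndsInTrue-replicate⁻ zero    e           = e
EndsInTrue-replicate⁻ (suc m) (false ∷ e) = EndsInTrue-replicate⁻ m e

trues : List Bool → ℕ
trues []           = 0
trues (true ∷ bs)  = suc (trues bs)
trues (false ∷ bs) = trues bs

trues-replicate-++ : ∀ m bs → trues (replicate m false ++ bs) ≡ trues bs
trues-replicate-++ zero    bs = refl
trues-replicate-++ (suc m) bs = trues-replicate-++ m bs

EndsInTrue⇒trues>0 : ∀ {bs} → EndsInTrue bs → 1 ≤ trues bs
EndsInTrue⇒trues>0 [true]      = s≤s z≤n
EndsInTrue⇒trues>0 (true ∷ e)  = s≤s z≤n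
EndsInTrue⇒trues>0 (false ∷ e) = EndsInTrue⇒trues>0 e

word : List ℕ → List Bool
word []       = []
word (x ∷ xs) = replicate (x ∸ 1) false ++ true ∷ word xs

-- gapsAfter a bs reads bs as if it were preceded by a falses.
gapsAfter : ℕ → List Bool → List ℕ
gapsAfter a []           = []
gapsAfter a (false ∷ bs) = gapsAfter (suc a) bs
gapsAfter a (true ∷ bs)  = suc a ∷ gapsAfter 0 bs

gaps : List Bool → List ℕ
gaps = gapsAfter 0

gapsAfter-replicate-++ : ∀ a m bs → gapsAfter a (replicate m false ++ bs) ≡ gapsAfter (m + a) bs
gapsAfter-replicate-++ a zero    bs = refl
gapsAfter-replicate-++ a (suc m) bs = trans (gapsAfter-replicate-++ (suc a) m bs) (cong (λ b → gapsAfter b bs) (+-suc m a))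

gaps-word : ∀ {xs} → All (1 ≤_) xs → gaps (word xs) ≡ xs
gaps-word []                      = refl
gaps-word {suc x ∷ xs} (_ ∷ xs>0) = begin
  gaps (replicate x false ++ true ∷ word xs) ≡⟨ gapsAfter-replicate-++ 0 x (true ∷ word xs) ⟩
  suc (x + 0) ∷ gaps (word xs)              ≡⟨ cong₂ (λ y ys → suc y ∷ ys) (+-identityʳ x) (gaps-word xs>0) ⟩
  suc x ∷ xs                                ∎
  where open ≡-Reasoning

word-gapsAfter : ∀ a {bs} → EndsInTrue bs → word (gapsAfter a bs) ≡ replicate a false ++ bs
word-gapsAfter a [true]             = refl
word-gapsAfter a (true ∷ e)         = cong (λ w → replicate a false ++ true ∷ w) (word-gapsAfter 0 e)
word-gapsAfter a (_∷_ false {bs} e) = trans (word-gapsAfter (suc a) e) (sym (replicate-++-∷ a false bs))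

word-gaps : ∀ {bs} → EndsInTrue bs → word (gaps bs) ≡ bs
word-gaps = word-gapsAfter 0

length-gapsAfter : ∀ a bs → length (gapsAfter a bs) ≡ trues bs
length-gapsAfter a []           = refl
length-gapsAfter a (false ∷ bs) = length-gapsAfter (suc a) bs
length-gapsAfter a (true ∷ bs)  = cong suc (length-gapsAfter 0 bs)

gapsAfter>0 : ∀ a bs → All (1 ≤_) (gapsAfter a bs)
gapsAfter>0 a []           = []
gapsAfter>0 a (false ∷ bs) = gapsAfter>0 (suc a) bs
gapsAfter>0 a (true ∷ bs)  = s≤s z≤n ∷ gapsAfter>0 0 bs

sum-gapsAfter : ∀ a {bs} → EndsInTrue bs → sum (gapsAfter a bs) ≡ a + length bs
sum-gapsAfter a [true]             = trans (+-identityʳ (suc a)) (+-comm 1 a)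
sum-gapsAfter a (_∷_ true {bs} e)  = trans (cong (suc a +_) (sum-gapsAfter 0 e)) (sym (+-suc a (length bs)))
sum-gapsAfter a (_∷_ false {bs} e) = trans (sum-gapsAfter (suc a) e) (sym (+-suc a (length bs)))

length-word : ∀ {xs} → All (1 ≤_) xs → length (word xs) ≡ sum xs
length-word []                      = refl
length-word {suc x ∷ xs} (_ ∷ xs>0) = begin
  length (replicate x false ++ true ∷ word xs)        ≡⟨ length-++ (replicate x false) ⟩
  length (replicate x false) + suc (length (word xs)) ≡⟨ cong₂ (λ m l → m + suc l) (length-replicate x) (length-word xs>0) ⟩
  x + suc (sum xs)                                    ≡⟨ +-suc x (sum xs) ⟩
  suc x + sum xs                                      ∎
  where open ≡-Reasoning

trues-word : ∀ xs → trues (word xs) ≡ length xs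
trues-word []       = refl
trues-word (x ∷ xs) = trans (trues-replicate-++ (x ∸ 1) (true ∷ word xs)) (cong suc (trues-word xs))

word-EndsInTrue : ∀ {xs} → 1 ≤ length xs → EndsInTrue (word xs)
word-EndsInTrue {x ∷ xs} _ = EndsInTrue-++ (replicate (x ∸ 1) false) (true∷word xs)
  where
  true∷word : ∀ xs → EndsInTrue (true ∷ word xs)
  true∷word []       = [true]
  true∷word (y ∷ ys) = true ∷ word-EndsInTrue {y ∷ ys} (s≤s z≤n)

-- The shape of the indicator word of a k-element set in 𝒮^(q+1).
record PaddedWord (q k : ℕ) (bs : List Bool) : Set where
  field
    rest       : List Bool
    split      : bs ≡ replicate (k ^ suc q) false ++ rest
    ends       : EndsInTrue rest
    trues-rest : trues rest ≡ k

module Shift (q : ℕ) where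

  toComposition : ℕ → List Bool → List ℕ
  toComposition k bs = map (_+ k ^ q) (gaps (drop (k ^ suc q) bs))

  fromComposition : ℕ → List ℕ → List Bool
  fromComposition k xs = replicate (k ^ suc q) false ++ word (map (_∸ k ^ q) xs)

  module _ {k : ℕ} {bs : List Bool} (w : PaddedWord q k bs) where
    open PaddedWord w

    PaddedWord⇒trues : trues bs ≡ k
    PaddedWord⇒trues = trans (cong trues split) (trans (trues-replicate-++ (k ^ suc q) rest) trues-rest)

    PaddedWord⇒k>0 : 1 ≤ k
    PaddedWord⇒k>0 = subst (1 ≤_) trues-rest (EndsInTrue⇒trues>0 ends)

    toComposition-PaddedWord : toComposition k bs ≡ map (_+ k ^ q) (gaps rest)
    toComposition-PaddedWord = begin
      map (_+ k ^ q) (gaps (drop (k ^ suc q) bs))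
        ≡⟨ cong (λ l → map (_+ k ^ q) (gaps (drop (k ^ suc q) l))) split ⟩
      map (_+ k ^ q) (gaps (drop (k ^ suc q) (replicate (k ^ suc q) false ++ rest)))
        ≡⟨ cong (λ l → map (_+ k ^ q) (gaps l)) (drop-replicate-++ (k ^ suc q) false rest) ⟩
      map (_+ k ^ q) (gaps rest) ∎
      where open ≡-Reasoning

    length-toComposition : length (toComposition k bs) ≡ k
    length-toComposition = begin
      length (toComposition k bs)              ≡⟨ cong length toComposition-PaddedWord ⟩
      length (map (_+ k ^ q) (gaps rest))      ≡⟨ length-map _ (gaps rest) ⟩
      length (gaps rest)                       ≡⟨ length-gapsAfter 0 rest ⟩
      trues rest                               ≡⟨ trues-rest ⟩
      k                                        ∎
      where open ≡-Reasoning

    sum-toComposition : sum (toComposition k bs) ≡ length bs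
    sum-toComposition = begin
      sum (toComposition k bs)                          ≡⟨ cong sum toComposition-PaddedWord ⟩
      sum (map (_+ k ^ q) (gaps rest))                  ≡⟨ sum-map-+ (k ^ q) (gaps rest) ⟩
      sum (gaps rest) + length (gaps rest) * k ^ q      ≡⟨ cong₂ (λ s l → s + l * k ^ q) (sum-gapsAfter 0 ends)
                                                                 (trans (length-gapsAfter 0 rest) trues-rest) ⟩
      length rest + k ^ suc q                           ≡⟨ +-comm (length rest) _ ⟩
      k ^ suc q + length rest                           ≡⟨ cong (_+ length rest) (length-replicate (k ^ suc q)) ⟨
      length (replicate (k ^ suc q) false) + length rest ≡⟨ length-++ (replicate (k ^ suc q) false) ⟨
      length (replicate (k ^ suc q) false ++ rest)      ≡⟨ cong length split ⟨
      length bs                                         ∎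
      where open ≡-Reasoning

    toComposition>k^q : All (k ^ q <_) (toComposition k bs)
    toComposition>k^q = subst (All (k ^ q <_)) (sym toComposition-PaddedWord)
      (map⁺ (All.map (m<n+m (k ^ q)) (gapsAfter>0 0 rest)))

    fromComposition∘toComposition : fromComposition k (toComposition k bs) ≡ bs
    fromComposition∘toComposition = begin
      fromComposition k (toComposition k bs)
        ≡⟨ cong (fromComposition k) toComposition-PaddedWord ⟩
      replicate (k ^ suc q) false ++ word (map (_∸ k ^ q) (map (_+ k ^ q) (gaps rest)))
        ≡⟨ cong (λ ds → replicate (k ^ suc q) false ++ word ds) (map-∸-+ (k ^ q) (gaps rest)) ⟩
      replicate (k ^ suc q) false ++ word (gaps rest)
        ≡⟨ cong (replicate (k ^ suc q) false ++_) (word-gaps ends) ⟩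
      replicate (k ^ suc q) false ++ rest
        ≡⟨ split ⟨
      bs ∎
      where open ≡-Reasoning

  module _ {k : ℕ} {xs : List ℕ} (c<xs : All (k ^ q <_) xs) where
    private
      ys : List ℕ
      ys = map (_∸ k ^ q) xs

      ys>0 : All (1 ≤_) ys
      ys>0 = map⁺ (All.map m<n⇒0<n∸m c<xs)

    fromComposition-PaddedWord : 1 ≤ k → length xs ≡ k → PaddedWord q k (fromComposition k xs)
    fromComposition-PaddedWord k>0 ∣xs∣≡k = record
      { rest       = word ys
      ; split      = refl
      ; ends       = word-EndsInTrue {ys} (subst (1 ≤_) (sym ∣ys∣≡k) k>0)
      ; trues-rest = trans (trues-word ys) ∣ys∣≡k
      }
      where
      ∣ys∣≡k : length ys ≡ k
      ∣ys∣≡k = trans (length-map _ xs) ∣xs∣≡k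

    length-fromComposition : length xs ≡ k → length (fromComposition k xs) ≡ sum xs
    length-fromComposition ∣xs∣≡k = begin
      length (replicate (k ^ suc q) false ++ word ys)          ≡⟨ length-++ (replicate (k ^ suc q) false) ⟩
      length (replicate (k ^ suc q) false) + length (word ys)  ≡⟨ cong₂ _+_ (length-replicate (k ^ suc q)) (length-word ys>0) ⟩
      k ^ suc q + sum ys                                       ≡⟨ +-comm (k ^ suc q) (sum ys) ⟩
      sum ys + k * k ^ q                                       ≡⟨ cong (λ m → sum ys + m * k ^ q) (trans (length-map _ xs) ∣xs∣≡k) ⟨
      sum ys + length ys * k ^ q                               ≡⟨ sum-map-+ (k ^ q) ys ⟨
      sum (map (_+ k ^ q) ys)                                  ≡⟨ cong sum (map-+-∸ (k ^ q) c<xs) ⟩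
      sum xs                                                   ∎
      where open ≡-Reasoning

    toComposition∘fromComposition : toComposition k (fromComposition k xs) ≡ xs
    toComposition∘fromComposition = begin
      map (_+ k ^ q) (gaps (drop (k ^ suc q) (replicate (k ^ suc q) false ++ word ys)))
        ≡⟨ cong (λ l → map (_+ k ^ q) (gaps l)) (drop-replicate-++ (k ^ suc q) false (word ys)) ⟩
      map (_+ k ^ q) (gaps (word ys))
        ≡⟨ cong (map (_+ k ^ q)) (gaps-word ys>0) ⟩
      map (_+ k ^ q) ys
        ≡⟨ map-+-∸ (k ^ q) c<xs ⟩
      xs ∎
      where open ≡-Reasoning

-- MinGt p S unfolds to Above (∣ S ∣ ^ p) S; freeing the bound from ∣ S ∣ allows induction on S.
Above : {n : ℕ} → ℕ → Subset n → Set
Above {n} K S = (i : Fin n) → i ∈ S → K < suc (toℕ i)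

¬Above-true : ∀ {n K} {S : Subset n} → 0 < K → ¬ Above K (true Vec.∷ S)
¬Above-true K>0 above = <⇒≱ (above zero here) K>0

∣∣≡trues : ∀ {n} (S : Subset n) → ∣ S ∣ ≡ trues (toList S)
∣∣≡trues Vec.[]          = refl
∣∣≡trues (true Vec.∷ S)  = cong suc (∣∣≡trues S)
∣∣≡trues (false Vec.∷ S) = ∣∣≡trues S

ContainsTop⇒EndsInTrue : ∀ {n} (S : Subset n) → ContainsTop S → EndsInTrue (toList S)
ContainsTop⇒EndsInTrue (true Vec.∷ Vec.[])  (zero , _ , here)         = [true]
ContainsTop⇒EndsInTrue (_ Vec.∷ _ Vec.∷ _)  (zero , () , _)
ContainsTop⇒EndsInTrue (b Vec.∷ c Vec.∷ S)  (suc i , top , there i∈S) =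
  b ∷ ContainsTop⇒EndsInTrue (c Vec.∷ S) (i , suc-injective top , i∈S)

EndsInTrue⇒ContainsTop : ∀ {n} (S : Subset n) → EndsInTrue (toList S) → ContainsTop S
EndsInTrue⇒ContainsTop (true Vec.∷ Vec.[]) [true]   = zero , refl , here
EndsInTrue⇒ContainsTop (b Vec.∷ Vec.[])    (_ ∷ ())
EndsInTrue⇒ContainsTop (b Vec.∷ c Vec.∷ S) (_ ∷ e)  =
  let i , top , i∈S = EndsInTrue⇒ContainsTop (c Vec.∷ S) e in suc i , cong suc top , there i∈S

Above-split : ∀ {n} K (S : Subset n) → Above K S → EndsInTrue (toList S) →
              toList S ≡ replicate K false ++ drop K (toList S)
Above-split zero    S                 _     _           = refl
Above-split (suc K) (true Vec.∷ S)    above _           = ⊥-elim (¬Above-true (s≤s z≤n) above)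
Above-split (suc K) (false Vec.∷ S)   above (false ∷ e) =
  cong (false ∷_) (Above-split K S (λ i i∈S → ≤-pred (above (suc i) (there i∈S))) e)

replicate-++⇒Above : ∀ {n} K (S : Subset n) {bs} → toList S ≡ replicate K false ++ bs → Above K S
replicate-++⇒Above zero    S          _  _ _ = s≤s z≤n
replicate-++⇒Above (suc K) (b Vec.∷ S) eq with ∷-injective eq
... | refl , eq′ = λ where
  zero    ()
  (suc i) (there i∈S) → s≤s (replicate-++⇒Above K S eq′ i i∈S)

-- Pads with false or truncates; only ever applied to lists of length n.
fitTo : (n : ℕ) → List Bool → Vec Bool n
fitTo zero    _        = Vec.[]
fitTo (suc n) []       = false Vec.∷ fitTo n []
fitTo (suc n) (b ∷ bs) = b Vec.∷ fitTo n bs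

fitTo-toList : ∀ {n} (v : Vec Bool n) → fitTo n (toList v) ≡ v
fitTo-toList Vec.[]      = refl
fitTo-toList (b Vec.∷ v) = cong (b Vec.∷_) (fitTo-toList v)

toList-fitTo : ∀ n bs → length bs ≡ n → toList (fitTo n bs) ≡ bs
toList-fitTo zero    []       _     = refl
toList-fitTo (suc n) (b ∷ bs) ∣bs∣≡ = cong (b ∷_) (toList-fitTo n bs (suc-injective ∣bs∣≡))

module _ (q : ℕ) {n : ℕ} {S : Subset n} where

  𝒮⇒PaddedWord : MinGt (suc q) S × ContainsTop S → PaddedWord q ∣ S ∣ (toList S)
  𝒮⇒PaddedWord (above , top) = record
    { rest       = drop K (toList S)
    ; split      = split
    ; ends       = EndsInTrue-replicate⁻ K (subst EndsInTrue split (ContainsTop⇒EndsInTrue S top))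
    ; trues-rest = sym (trans (∣∣≡trues S) (trans (cong trues split) (trues-replicate-++ K _)))
    }
    where
    K : ℕ
    K = ∣ S ∣ ^ suc q
    split : toList S ≡ replicate K false ++ drop K (toList S)
    split = Above-split K S above (ContainsTop⇒EndsInTrue S top)

  PaddedWord⇒𝒮 : ∀ {k} → PaddedWord q k (toList S) → MinGt (suc q) S × ContainsTop S
  PaddedWord⇒𝒮 {k} w =
    subst (λ m → Above (m ^ suc q) S) (sym ∣S∣≡k) (replicate-++⇒Above (k ^ suc q) S split) ,
    EndsInTrue⇒ContainsTop S (subst EndsInTrue (sym split) (EndsInTrue-++ (replicate (k ^ suc q) false) ends))
    where
    open PaddedWord w
    ∣S∣≡k : ∣ S ∣ ≡ k
    ∣S∣≡k = trans (∣∣≡trues S) (Shift.PaddedWord⇒trues q w)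

IsKComp-fromList : ∀ n q (xs : List ℕ) → 1 ≤ length xs → sum xs ≡ n → All (length xs ^ q <_) xs →
                   IsKComp n q (length xs) (fromList xs)
IsKComp-fromList n q xs ∣xs∣>0 Σxs≡n c<xs =
  ∣xs∣>0 ,
  trans (sum-toList (fromList xs)) (trans (cong sum (toList∘fromList xs)) Σxs≡n) ,
  fromList⁺ (All.map (≤-trans (s≤s z≤n)) c<xs) ,
  fromList⁺ c<xs

IsKComp-toList : ∀ n q {k} {x : Vec ℕ k} → IsKComp n q k x → sum (toList x) ≡ n × All (k ^ q <_) (toList x)
IsKComp-toList n q {x = x} (_ , Σx≡n , _ , c<x) = trans (sym (sum-toList x)) Σx≡n , toList⁺ c<x

𝒮↔KComp : (n q : ℕ) → 𝒮 (suc q) n ↔ KComp n q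
𝒮↔KComp n q = ↔-trans (restrict (λ S → minGt? (suc q) S ×-dec containsTop? S)
                                  (λ y → isKComp? n q (proj₁ y) (proj₂ y)) bijection)
                       Σ-assoc
  where
  open Shift q

  composition : Subset n → List ℕ
  composition S = toComposition ∣ S ∣ (toList S)

  subset : ℕ → List ℕ → Subset n
  subset k xs = fitTo n (fromComposition k xs)

  module Of𝒮 {S : Subset n} (S∈𝒮 : MinGt (suc q) S × ContainsTop S) where
    w : PaddedWord q ∣ S ∣ (toList S)
    w = 𝒮⇒PaddedWord q S∈𝒮

    ∣composition∣ : length (composition S) ≡ ∣ S ∣
    ∣composition∣ = length-toComposition w

  module OfKComp {k : ℕ} {x : Vec ℕ k} (x∈K : IsKComp n q k x) where
    Σx≡n : sum (toList x) ≡ n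
    Σx≡n = proj₁ (IsKComp-toList n q x∈K)

    c<x : All (k ^ q <_) (toList x)
    c<x = proj₂ (IsKComp-toList n q x∈K)

    toList-subset : toList (subset k (toList x)) ≡ fromComposition k (toList x)
    toList-subset = toList-fitTo n _ (trans (length-fromComposition c<x (length-toList x)) Σx≡n)

    w : PaddedWord q k (toList (subset k (toList x)))
    w = subst (PaddedWord q k) (sym toList-subset) (fromComposition-PaddedWord c<x (proj₁ x∈K) (length-toList x))

    ∣subset∣ : ∣ subset k (toList x) ∣ ≡ k
    ∣subset∣ = trans (∣∣≡trues (subset k (toList x))) (PaddedWord⇒trues w)

  bijection : BijectionOn (λ S → MinGt (suc q) S × ContainsTop S) (λ y → IsKComp n q (proj₁ y) (proj₂ y))
  bijection = record
    { to      = λ S → length (composition S) , fromList (composition S)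
    ; from    = λ (k , x) → subset k (toList x)
    ; to-∈    = λ {S} S∈𝒮 → let open Of𝒮 S∈𝒮 in
        IsKComp-fromList n q (composition S)
          (subst (1 ≤_) (sym ∣composition∣) (PaddedWord⇒k>0 w))
          (trans (sum-toComposition w) (length-toList S))
          (subst (λ m → All (m ^ q <_) (composition S)) (sym ∣composition∣) (toComposition>k^q w))
    ; from-∈  = λ x∈K → PaddedWord⇒𝒮 q (OfKComp.w x∈K)
    ; from∘to = λ {S} S∈𝒮 → let open Of𝒮 S∈𝒮 in begin
        subset (length (composition S)) (toList (fromList (composition S)))
          ≡⟨ cong₂ subset ∣composition∣ (toList∘fromList (composition S)) ⟩
        fitTo n (fromComposition ∣ S ∣ (composition S))
          ≡⟨ cong (fitTo n) (fromComposition∘toComposition w) ⟩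
        fitTo n (toList S)
          ≡⟨ fitTo-toList S ⟩
        S ∎
    ; to∘from = λ {(k , x)} x∈K → let open OfKComp x∈K in
        trans (cong (λ xs → length xs , fromList xs)
                    (trans (cong₂ toComposition ∣subset∣ toList-subset)
                           (toComposition∘fromComposition c<x)))
              (Σ-fromList∘toList x)
    }
    where open ≡-Reasoning

𝒮-suc↔𝒜 : (n q : ℕ) → 𝒮 (suc q) (suc n) ↔ 𝒜 (suc q) n
𝒮-suc↔𝒜 n q = restrict (λ S → minGt? (suc q) S ×-dec containsTop? S)
                        (λ S → minGe? (suc q) S ×-dec containsTop? S)
  record
    { to      = Vec.tail
    ; from    = false Vec.∷_
    ; to-∈    = to-∈
    ; from-∈  = λ (above , i , top , i∈S) →
        (λ where (suc j) (there j∈S) → s≤s (above j j∈S)) , suc i , cong suc top , there i∈S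
    ; from∘to = from∘to
    ; to∘from = λ _ → refl
    }
  where
  1∉S : ∀ {S : Subset n} → ¬ MinGt (suc q) (true Vec.∷ S)
  1∉S {S} = ¬Above-true (m^n>0 (suc ∣ S ∣) (suc q))

  to-∈ : ∀ {S : Subset (suc n)} → MinGt (suc q) S × ContainsTop S → MinGe (suc q) (Vec.tail S) × ContainsTop (Vec.tail S)
  to-∈ {true Vec.∷ S}  (above , _) = ⊥-elim (1∉S above)
  to-∈ {false Vec.∷ S} (above , suc i , top , there i∈S) =
    (λ j j∈S → ≤-pred (above (suc j) (there j∈S))) , i , suc-injective top , i∈S

  from∘to : ∀ {S : Subset (suc n)} → MinGt (suc q) S × ContainsTop S → false Vec.∷ Vec.tail S ≡ S
  from∘to {true Vec.∷ S}  (above , _) = ⊥-elim (1∉S above)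
  from∘to {false Vec.∷ S} _           = refl

𝒜₀↔Fin0 : (p : ℕ) → 𝒜 p 0 ↔ Fin 0
𝒜₀↔Fin0 p = mk↔ₛ′ top (λ ()) (λ ()) (λ A → ⊥-elim (¬Fin0 (top A)))
  where
  top : 𝒜 p 0 → Fin 0
  top (S , t) = proj₁ (proj₂ (toWitness {a? = minGe? p S ×-dec containsTop? S} t))

theorem4 : (n p : ℕ) → 1 ≤ n → 1 ≤ p →
    (𝒮 p n ↔ KComp n (p ∸ 1))
    × (𝒮 p 1 ↔ Fin 0)
    × (𝒮 p (suc n) ↔ 𝒜 p n)
    × (𝒜 p n ↔ KComp (suc n) (p ∸ 1))
theorem4 n (suc q) _ _ =
  𝒮↔KComp n q ,
  ↔-trans (𝒮-suc↔𝒜 0 q) (𝒜₀↔Fin0 (suc q)) ,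
  𝒮-suc↔𝒜 n q ,
  ↔-trans (↔-sym (𝒮-suc↔𝒜 n q)) (𝒮↔KComp (suc n) q)
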